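{- For every integer $d \ge 2$, $Z_{(1)}(Q_d) = 2^{d-1}$, where $Q_d$ is the $d$-dimensional hypercube.
   Context: $Q_d$ is the $d$-fold Cartesian product $K_2\Box\cdots\Box K_2$ (equivalently, vertices are binary strings of length $d$, adjacent iff they differ in exactly one coordinate). Let $G=(V,E)$ be a finite simple graph. Color-change rule (zero forcing): given a set of colored vertices, a colored vertex with exactly one uncolored neighbor colors ("forces") that neighbor. Leaks: for a set $L\subseteq V$, placing a leak on each $v\in L$ means attaching to $v$ one new pendant vertex (adjacent only to $v$) which is never initially colored; consequently no vertex of $L$ can ever force a vertex of $V$. A set $S\subseteq V$ is an $\ell$-forcing set if for every $L\subseteq V$ with $|L|\le \ell$, starting with exactly the vertices of $S$ colored and repeatedly applying the color-change rule in the graph with leaks on $L$, every vertex of $V$ eventually becomes colored. $Z_{(\ell)}(G)$ is the minimum size of an $\ell$-forcing set. -}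

module Defs where

open import Data.Nat using (ℕ; zero; suc; _+_; _≤_)
open import Data.Product using (Σ; _×_)
open import Data.Bool using (Bool; true; false)
open import Data.List using (List; []; _∷_; _++_; map; filter; length)
open import Data.Vec using (Vec; []; _∷_)
open import Relation.Binary.PropositionalEquality using (_≡_; _≢_)
open import Relation.Nullary using (¬_)
open import Relation.Nullary.Decidable using (Dec; yes; no)

record Graph : Set₁ where
  field
    V     : Set
    verts : List V          -- enumeration of all vertices (each exactly once)
    Adj   : V → V → Set

VSet : Graph → Set
VSet G = Graph.V G → Bool

size : (G : Graph) → VSet G → ℕ
size G S = length (filter (λ v → isT (S v)) (Graph.verts G))
  where
  isT : (b : Bool) → Dec (b ≡ true)
  isT true  = yes _≡_.refl
  isT false = no (λ ())

-- The final coloured set of the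
-- colour-change process is the closure under the forcing rule; a vertex
-- with a leak never forces a vertex of V.

data Colored (G : Graph) (S L : VSet G) : Graph.V G → Set where
  initial : ∀ {v} → S v ≡ true → Colored G S L v
  force   : ∀ {u v} → Colored G S L u → L u ≡ false → Graph.Adj G u v →
            (∀ w → Graph.Adj G u w → w ≢ v → Colored G S L w) →
            Colored G S L v

IsForcingSet : (ℓ : ℕ) (G : Graph) → VSet G → Set
IsForcingSet ℓ G S =
  ∀ (L : VSet G) → size G L ≤ ℓ → ∀ v → Colored G S L v

ZℓIs : (ℓ : ℕ) (G : Graph) (k : ℕ) → Set
ZℓIs ℓ G k =
  (Σ (VSet G) (λ S → IsForcingSet ℓ G S × size G S ≡ k)) ×
  (∀ S → IsForcingSet ℓ G S → k ≤ size G S)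

allVecs : (d : ℕ) → List (Vec Bool d)
allVecs zero    = [] ∷ []
allVecs (suc d) = map (false ∷_) (allVecs d) ++ map (true ∷_) (allVecs d)

hamming : ∀ {d} → Vec Bool d → Vec Bool d → ℕ
hamming []       []       = 0
hamming (x ∷ xs) (y ∷ ys) = diff x y + hamming xs ys
  where
  diff : Bool → Bool → ℕ
  diff true  false = 1
  diff false true  = 1
  diff _     _     = 0

Q : ℕ → Graph
Q d = record
  { V     = Vec Bool d
  ; verts = allVecs d
  ; Adj   = λ x y → hamming x y ≡ 1
  }

-- Upper bound: the vertices with first coordinate 0 form a 1-forcing set.  Each 1x is
-- forced by 0x; if 0x carries the leak, 1x is forced instead by a neighbour 1x′ in the
-- top half, whose own forcer 0x′ is leak-free.
--
-- Lower bound (already for plain zero forcing, whatever the leaks): work over 𝔽₂, with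
-- vectors indexed by vertices as Boolean functions.  If f is a null vector of A + eI (A the
-- adjacency matrix) and f vanishes on S, then f vanishes on every vertex coloured from S:
-- when u forces v, row u of (A + eI) f = 0 reads f v = 0.  Over 𝔽₂ the adjacency matrix of
-- Q n squares to n·I, so B = A + (n+1)I is an involution, and since the matrix A + (n+1)I
-- of Q (n+1) is [[B, I], [I, B]], every (g, Bg) is a null vector.  These form a space of
-- dimension 2ⁿ, which a set of fewer than 2ⁿ vertices cannot pin down.

module Submission where

open import Defs
open import Data.Nat using (ℕ; _≤_; _^_; _∸_)
open import Data.Nat using (zero; suc; _+_; _<_; z≤n; s≤s; s<s⁻¹)
open import Data.Nat.Properties using (suc-injective; +-identityʳ; ≮⇒≥)
open import Data.Bool using (Bool; true; false; not; _∧_; _xor_)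
open import Data.Bool.Properties
  using (_≟_; xor-∧-commutativeRing; xor-assoc; xor-same; xor-identityʳ; xor-inverseˡ;
         ∧-zeroʳ; ∧-identityʳ; ∧-distribˡ-xor; not-involutive; not-¬; ¬-not)
open import Algebra.Bundles using (CommutativeRing)
open import Algebra.Properties.CommutativeSemigroup
  (CommutativeRing.+-commutativeSemigroup xor-∧-commutativeRing)
  using (interchange; x∙yz≈y∙xz)
open import Data.Fin using (Fin; zero; suc; combine; quotient; remainder)
open import Data.Fin.Properties using (combine-remQuot)
open import Data.Vec using (Vec; []; _∷_)
open import Data.Vec.Properties using (∷-injectiveˡ; ∷-injectiveʳ)
open import Data.Vec.Functional using () renaming (_∷_ to _∷ᶠ_)
open import Data.List using (List; []; _∷_; _++_; map; filter; length)
open import Data.List.Properties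
  using (length-map; length-++; filter-++; filter-all; filter-none; ++-identityʳ; length-removeAt′)
open import Data.List.Membership.Propositional using (_∈_)
open import Data.List.Membership.Propositional.Properties using (∈-map⁺; ∈-++⁺ˡ; ∈-++⁺ʳ; ∈-filter⁺)
open import Data.List.Relation.Unary.Any as Any using (Any; here; index; _─_)
open import Data.List.Relation.Unary.All as All using (All; all?; universal; lookupAny)
open import Data.List.Relation.Unary.All.Properties using (map⁺; map⁻; ─⁺; ─⁻; ¬All⇒Any¬)
open import Data.Product using (_×_; _,_; ∃-syntax)
open import Data.Empty using (⊥; ⊥-elim)
open import Function using (_∘_)
open import Relation.Nullary using (yes; no)
open import Relation.Binary.PropositionalEquality
open ≡-Reasoning

odd : ℕ → Bool
odd zero    = false
odd (suc n) = not (odd n)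

xor-cancelʳ : ∀ a s → (a xor s) xor s ≡ a
xor-cancelʳ a s = begin
  (a xor s) xor s ≡⟨ xor-assoc a s s ⟩
  a xor (s xor s) ≡⟨ cong (a xor_) (xor-same s) ⟩
  a xor false     ≡⟨ xor-identityʳ a ⟩
  a               ∎

xor-cancel-middle : ∀ a s t → (a xor s) xor (s xor t) ≡ a xor t
xor-cancel-middle a s t =
  trans (sym (xor-assoc (a xor s) s t)) (cong (_xor t) (xor-cancelʳ a s))

xor-∧-self : ∀ p a → a xor (p ∧ a) ≡ not p ∧ a
xor-∧-self true  a = xor-same a
xor-∧-self false a = xor-identityʳ a

hamming-refl : ∀ {n} (x : Vec Bool n) → hamming x x ≡ 0
hamming-refl []          = refl
hamming-refl (false ∷ x) = hamming-refl x
hamming-refl (true ∷ x)  = hamming-refl x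

hamming-sym : ∀ {n} (x y : Vec Bool n) → hamming x y ≡ hamming y x
hamming-sym []          []          = refl
hamming-sym (false ∷ x) (false ∷ y) = hamming-sym x y
hamming-sym (false ∷ x) (true ∷ y)  = cong suc (hamming-sym x y)
hamming-sym (true ∷ x)  (false ∷ y) = cong suc (hamming-sym x y)
hamming-sym (true ∷ x)  (true ∷ y)  = hamming-sym x y

hamming≡0⇒≡ : ∀ {n} {x y : Vec Bool n} → hamming x y ≡ 0 → x ≡ y
hamming≡0⇒≡ {x = []}        {[]}        _ = refl
hamming≡0⇒≡ {x = false ∷ x} {false ∷ y} h = cong (false ∷_) (hamming≡0⇒≡ h)
hamming≡0⇒≡ {x = true ∷ x}  {true ∷ y}  h = cong (true ∷_) (hamming≡0⇒≡ h)

data Neighbour {n : ℕ} : Vec Bool (suc n) → Vec Bool (suc n) → Set where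
  flipHead : ∀ b x → Neighbour (b ∷ x) (not b ∷ x)
  inTail   : ∀ b x y → hamming x y ≡ 1 → Neighbour (b ∷ x) (b ∷ y)

neighbour : ∀ {n} (u v : Vec Bool (suc n)) → hamming u v ≡ 1 → Neighbour u v
neighbour (false ∷ x) (false ∷ y) h = inTail false x y h
neighbour (true ∷ x)  (true ∷ y)  h = inTail true x y h
neighbour (false ∷ x) (true ∷ y)  h with refl ← hamming≡0⇒≡ {x = x} {y} (suc-injective h) =
  flipHead false x
neighbour (true ∷ x)  (false ∷ y) h with refl ← hamming≡0⇒≡ {x = x} {y} (suc-injective h) =
  flipHead true x

Neighbour⇒adjacent : ∀ {n} {u v : Vec Bool (suc n)} → Neighbour u v → hamming u v ≡ 1
Neighbour⇒adjacent (flipHead false x) = cong suc (hamming-refl x)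
Neighbour⇒adjacent (flipHead true x)  = cong suc (hamming-refl x)
Neighbour⇒adjacent (inTail false _ _ h) = h
Neighbour⇒adjacent (inTail true _ _ h)  = h

size-filter : ∀ G (S : VSet G) →
              size G S ≡ length (filter (λ v → S v ≟ true) (Graph.verts G))
size-filter G S = along (Graph.verts G)
  where
  along : ∀ xs → size (record G { verts = xs }) S ≡ length (filter (λ v → S v ≟ true) xs)
  along []       = refl
  along (x ∷ xs) with S x
  ... | true  = cong suc (along xs)
  ... | false = along xs

size-∅ : ∀ G → size G (λ _ → false) ≡ 0
size-∅ G =
  trans (size-filter G (λ _ → false)) (cong length
    (filter-none (λ (_ : Graph.V G) → false ≟ true) (universal (λ _ ()) (Graph.verts G))))

∈-allVecs : ∀ {n} (x : Vec Bool n) → x ∈ allVecs n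
∈-allVecs []                  = here refl
∈-allVecs {suc n} (false ∷ x) = ∈-++⁺ˡ (∈-map⁺ (false ∷_) (∈-allVecs x))
∈-allVecs {suc n} (true ∷ x)  =
  ∈-++⁺ʳ (map (false ∷_) (allVecs n)) (∈-map⁺ (true ∷_) (∈-allVecs x))

length-allVecs : ∀ n → length (allVecs n) ≡ 2 ^ n
length-allVecs zero    = refl
length-allVecs (suc n) = begin
  length (map (false ∷_) (allVecs n) ++ map (true ∷_) (allVecs n))
    ≡⟨ length-++ (map (false ∷_) (allVecs n)) ⟩
  length (map (false ∷_) (allVecs n)) + length (map (true ∷_) (allVecs n))
    ≡⟨ cong₂ _+_ (length-map _ (allVecs n)) (length-map _ (allVecs n)) ⟩
  length (allVecs n) + length (allVecs n)
    ≡⟨ cong (λ k → k + k) (length-allVecs n) ⟩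
  2 ^ n + 2 ^ n
    ≡⟨ cong (2 ^ n +_) (+-identityʳ (2 ^ n)) ⟨
  2 ^ suc n ∎

length≤1-∈⇒≡ : ∀ {A : Set} {xs : List A} {a b} →
               length xs ≤ 1 → a ∈ xs → b ∈ xs → a ≡ b
length≤1-∈⇒≡ {xs = _ ∷ _ ∷ _} (s≤s ())
length≤1-∈⇒≡ {xs = _ ∷ []} _ (here refl) (here refl) = refl

size≤1⇒leakFree : ∀ {n} (L : VSet (Q n)) → size (Q n) L ≤ 1 →
                  ∀ {a b} → L a ≡ true → a ≢ b → L b ≡ false
size≤1⇒leakFree {n} L oneLeak La a≢b = ¬-not λ Lb → a≢b (length≤1-∈⇒≡
  (subst (_≤ 1) (size-filter (Q n) L) oneLeak)
  (∈-filter⁺ (λ v → L v ≟ true) (∈-allVecs _) La)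
  (∈-filter⁺ (λ v → L v ≟ true) (∈-allVecs _) Lb))

-- Upper bound

lowerHalf : ∀ {n} → Vec Bool (suc n) → Bool
lowerHalf (b ∷ _) = not b

size-lowerHalf : ∀ n → size (Q (suc n)) lowerHalf ≡ 2 ^ n
size-lowerHalf n = begin
  size (Q (suc n)) lowerHalf                 ≡⟨ size-filter (Q (suc n)) lowerHalf ⟩
  length (filter P? (bottom ++ top))         ≡⟨ cong length (filter-++ P? bottom top) ⟩
  length (filter P? bottom ++ filter P? top) ≡⟨ cong₂ (λ xs ys → length (xs ++ ys))
                                                      bottom-kept top-dropped ⟩
  length (bottom ++ [])                      ≡⟨ cong length (++-identityʳ bottom) ⟩
  length bottom                              ≡⟨ length-map _ (allVecs n) ⟩
  length (allVecs n)                         ≡⟨ length-allVecs n ⟩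
  2 ^ n                                      ∎
  where
  P? = λ (v : Vec Bool (suc n)) → lowerHalf v ≟ true
  bottom top : List (Vec Bool (suc n))
  bottom = map (false ∷_) (allVecs n)
  top    = map (true ∷_) (allVecs n)
  bottom-kept : filter P? bottom ≡ bottom
  bottom-kept = filter-all P? (map⁺ (universal (λ _ → refl) (allVecs n)))
  top-dropped : filter P? top ≡ []
  top-dropped = filter-none P? (map⁺ (universal (λ _ ()) (allVecs n)))

forcedFromBelow : ∀ {n} {L : VSet (Q (suc n))} x → L (false ∷ x) ≡ false →
                  Colored (Q (suc n)) lowerHalf L (true ∷ x)
forcedFromBelow {n} {L} x noLeak =
  force (initial refl) noLeak (Neighbour⇒adjacent (flipHead false x)) others
  where
  others : ∀ w → hamming (false ∷ x) w ≡ 1 → w ≢ true ∷ x → Colored (Q (suc n)) lowerHalf L w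
  others w x~w w≢ with neighbour (false ∷ x) w x~w
  ... | flipHead _ _ = ⊥-elim (w≢ refl)
  ... | inTail _ _ _ _ = initial refl

forcedBesideLeak : ∀ {n} {L : VSet (Q (suc (suc n)))} → size (Q (suc (suc n))) L ≤ 1 →
                   ∀ c z → L (false ∷ c ∷ z) ≡ true →
                   Colored (Q (suc (suc n))) lowerHalf L (true ∷ c ∷ z)
forcedBesideLeak {n} {L} oneLeak c z leak =
  force (forcedFromBelow x′ (leakFree (not-¬ refl ∘ ∷-injectiveˡ ∘ ∷-injectiveʳ)))
        (leakFree λ ()) x′~x others
  where
  x′ = not c ∷ z
  leakFree : ∀ {v} → false ∷ c ∷ z ≢ v → L v ≡ false
  leakFree = size≤1⇒leakFree L oneLeak leak
  x′~x : hamming (true ∷ x′) (true ∷ c ∷ z) ≡ 1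
  x′~x = trans (hamming-sym x′ (c ∷ z)) (Neighbour⇒adjacent (flipHead c z))
  others : ∀ w → hamming (true ∷ x′) w ≡ 1 → w ≢ true ∷ c ∷ z →
           Colored (Q (suc (suc n))) lowerHalf L w
  others w x′~w w≢ with neighbour (true ∷ x′) w x′~w
  ... | flipHead _ _ = initial refl
  ... | inTail _ _ y _ =
    forcedFromBelow y (leakFree λ eq → w≢ (cong (true ∷_) (sym (∷-injectiveʳ eq))))

lowerHalf-isForcingSet : ∀ n → IsForcingSet 1 (Q (suc (suc n))) lowerHalf
lowerHalf-isForcingSet n L oneLeak (false ∷ x) = initial refl
lowerHalf-isForcingSet n L oneLeak (true ∷ c ∷ z) with L (false ∷ c ∷ z) in leak
... | false = forcedFromBelow (c ∷ z) leak
... | true  = forcedBesideLeak oneLeak c z leak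

-- The adjacency operator of Q n over 𝔽₂

adj : ∀ {n} → (Vec Bool n → Bool) → Vec Bool n → Bool
adj f []      = false
adj f (b ∷ x) = f (not b ∷ x) xor adj (λ y → f (b ∷ y)) x

adj-vanishing : ∀ {n} (f : Vec Bool n → Bool) u →
                (∀ w → hamming u w ≡ 1 → f w ≡ false) → adj f u ≡ false
adj-vanishing f []      _   = refl
adj-vanishing f (b ∷ x) f≡0 = cong₂ _xor_
  (f≡0 _ (Neighbour⇒adjacent (flipHead b x)))
  (adj-vanishing _ x λ w x~w → f≡0 (b ∷ w) (Neighbour⇒adjacent (inTail b x w x~w)))

adj-lone : ∀ {n} (f : Vec Bool n → Bool) u v → hamming u v ≡ 1 →
           (∀ w → hamming u w ≡ 1 → w ≢ v → f w ≡ false) → adj f u ≡ f v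
adj-lone f [] [] ()
adj-lone f (b ∷ x) v u~v f≡0 with neighbour (b ∷ x) v u~v
... | flipHead _ _ = begin
  f (not b ∷ x) xor adj (λ y → f (b ∷ y)) x
    ≡⟨ cong (f (not b ∷ x) xor_) (adj-vanishing _ x λ w x~w →
         f≡0 (b ∷ w) (Neighbour⇒adjacent (inTail b x w x~w)) (not-¬ refl ∘ ∷-injectiveˡ)) ⟩
  f (not b ∷ x) xor false
    ≡⟨ xor-identityʳ _ ⟩
  f (not b ∷ x) ∎
... | inTail _ _ y x~y = begin
  f (not b ∷ x) xor adj (λ y → f (b ∷ y)) x
    ≡⟨ cong (_xor adj (λ y → f (b ∷ y)) x)
         (f≡0 _ (Neighbour⇒adjacent (flipHead b x)) (not-¬ refl ∘ sym ∘ ∷-injectiveˡ)) ⟩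
  adj (λ y → f (b ∷ y)) x
    ≡⟨ adj-lone (λ y → f (b ∷ y)) x y x~y (λ w x~w w≢y →
         f≡0 (b ∷ w) (Neighbour⇒adjacent (inTail b x w x~w)) (w≢y ∘ ∷-injectiveʳ)) ⟩
  f (b ∷ y) ∎

adj-linear : ∀ {n} (f g : Vec Bool n → Bool) {h} → (∀ y → h y ≡ f y xor g y) →
             ∀ x → adj h x ≡ adj f x xor adj g x
adj-linear f g h≡ []      = refl
adj-linear f g h≡ (b ∷ x) = trans
  (cong₂ _xor_ (h≡ (not b ∷ x)) (adj-linear f′ g′ (λ y → h≡ (b ∷ y)) x))
  (interchange (f (not b ∷ x)) (g (not b ∷ x)) (adj f′ x) (adj g′ x))
  where
  f′ g′ : Vec Bool _ → Bool
  f′ y = f (b ∷ y)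
  g′ y = g (b ∷ y)

adj-scale : ∀ {n} e (f : Vec Bool n → Bool) x → adj (λ y → e ∧ f y) x ≡ e ∧ adj f x
adj-scale true  f x = refl
adj-scale false f x = adj-vanishing _ x λ _ _ → refl

adj² : ∀ {n} (f : Vec Bool n → Bool) x → adj (adj f) x ≡ odd n ∧ f x
adj² f []              = refl
adj² {suc n} f (b ∷ x) = begin
  adj (adj f) (b ∷ x)
    ≡⟨ cong₂ _xor_ (cong (λ c → f (c ∷ x) xor s) (not-involutive b))
                   (trans (adj-linear (λ y → f (not b ∷ y)) (adj (λ y → f (b ∷ y))) (λ _ → refl) x)
                          (cong (s xor_) (adj² _ x))) ⟩
  (f (b ∷ x) xor s) xor (s xor (odd n ∧ f (b ∷ x)))
    ≡⟨ xor-cancel-middle (f (b ∷ x)) s _ ⟩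
  f (b ∷ x) xor (odd n ∧ f (b ∷ x))
    ≡⟨ xor-∧-self (odd n) (f (b ∷ x)) ⟩
  not (odd n) ∧ f (b ∷ x) ∎
  where
  s = adj (λ y → f (not b ∷ y)) x

shiftedAdj : ∀ {n} → Bool → (Vec Bool n → Bool) → Vec Bool n → Bool
shiftedAdj e f x = (e ∧ f x) xor adj f x

shiftedAdj-linear : ∀ {n} e (f g : Vec Bool n → Bool) {h} → (∀ y → h y ≡ f y xor g y) →
                    ∀ x → shiftedAdj e h x ≡ shiftedAdj e f x xor shiftedAdj e g x
shiftedAdj-linear e f g h≡ x = trans
  (cong₂ _xor_ (trans (cong (e ∧_) (h≡ x)) (∧-distribˡ-xor e (f x) (g x)))
               (adj-linear f g h≡ x))
  (interchange (e ∧ f x) (e ∧ g x) (adj f x) (adj g x))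

shiftedAdj² : ∀ {n} e (f : Vec Bool n → Bool) x →
              shiftedAdj e (shiftedAdj e f) x ≡ (e xor odd n) ∧ f x
shiftedAdj² {n} e f x =
  trans (cong ((e ∧ shiftedAdj e f x) xor_) adj-shifted) (expand e)
  where
  adj-shifted : adj (shiftedAdj e f) x ≡ (e ∧ adj f x) xor (odd n ∧ f x)
  adj-shifted = trans (adj-linear (λ y → e ∧ f y) (adj f) (λ _ → refl) x)
                      (cong₂ _xor_ (adj-scale e f x) (adj² f x))
  expand : ∀ e → (e ∧ ((e ∧ f x) xor adj f x)) xor ((e ∧ adj f x) xor (odd n ∧ f x))
               ≡ (e xor odd n) ∧ f x
  expand false = refl
  expand true  = trans (xor-cancel-middle (f x) (adj f x) _) (xor-∧-self (odd n) (f x))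

shiftedAdj-involutive : ∀ {n} (f : Vec Bool n → Bool) x →
                        shiftedAdj (odd (suc n)) (shiftedAdj (odd (suc n)) f) x ≡ f x
shiftedAdj-involutive {n} f x =
  trans (shiftedAdj² (odd (suc n)) f x) (cong (_∧ f x) (xor-inverseˡ (odd n)))

InKernel : ∀ {n} → Bool → (Vec Bool n → Bool) → Set
InKernel e f = ∀ u → shiftedAdj e f u ≡ false

inKernel-vanishes : ∀ {n e} {f : Vec Bool n → Bool} {S L : VSet (Q n)} → InKernel e f →
                    (∀ v → S v ≡ true → f v ≡ false) → ∀ {v} → Colored (Q n) S L v → f v ≡ false
inKernel-vanishes ker f|S (initial Sv) = f|S _ Sv
inKernel-vanishes {e = e} {f} ker f|S (force {u} {v} u-colored _ u~v others) = begin
  f v                     ≡⟨ adj-lone f u v u~v (λ w u~w w≢v → vanishes (others w u~w w≢v)) ⟨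
  adj f u                 ≡⟨ cong (_xor adj f u) (∧-zeroʳ e) ⟨
  (e ∧ false) xor adj f u ≡⟨ cong (λ a → (e ∧ a) xor adj f u) (vanishes u-colored) ⟨
  shiftedAdj e f u        ≡⟨ ker u ⟩
  false                   ∎
  where
  vanishes : ∀ {w} → Colored _ _ _ w → f w ≡ false
  vanishes = inKernel-vanishes {e = e} ker f|S

-- In block form the matrix A + eI of Q (suc n) is [[B, I], [I, B]] with B = A + eI on Q n.
extend : ∀ {n} → Bool → (Vec Bool n → Bool) → Vec Bool (suc n) → Bool
extend e g (false ∷ x) = g x
extend e g (true ∷ x)  = shiftedAdj e g x

extend-inKernel : ∀ {n} e (g : Vec Bool n → Bool) →
                  (∀ x → shiftedAdj e (shiftedAdj e g) x ≡ g x) → InKernel e (extend e g)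
extend-inKernel e g B²g≡g (false ∷ x) =
  trans (cong ((e ∧ g x) xor_) (xor-cancelʳ (e ∧ g x) (adj g x))) (xor-same (e ∧ g x))
extend-inKernel e g B²g≡g (true ∷ x)  = begin
  (e ∧ shiftedAdj e g x) xor (g x xor adj (shiftedAdj e g) x)
    ≡⟨ x∙yz≈y∙xz (e ∧ shiftedAdj e g x) (g x) _ ⟩
  g x xor shiftedAdj e (shiftedAdj e g) x
    ≡⟨ cong (g x xor_) (B²g≡g x) ⟩
  g x xor g x
    ≡⟨ xor-same (g x) ⟩
  false ∎

extend-linear : ∀ {n} e (f g : Vec Bool n → Bool) {h} → (∀ y → h y ≡ f y xor g y) →
                ∀ u → extend e h u ≡ extend e f u xor extend e g u
extend-linear e f g h≡ (false ∷ x) = h≡ x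
extend-linear e f g h≡ (true ∷ x)  = shiftedAdj-linear e f g h≡ x

-- Linear algebra over 𝔽₂

IsLinear : ∀ {N} → ((Fin N → Bool) → Bool) → Set
IsLinear φ = ∀ f g {h} → (∀ i → h i ≡ f i xor g i) → φ h ≡ φ f xor φ g

unit₀ : ∀ {N} → Fin (suc N) → Bool
unit₀ = true ∷ᶠ λ _ → false

linear-∷ : ∀ {N} {φ : (Fin (suc N) → Bool) → Bool} → IsLinear φ →
           ∀ b y → φ (b ∷ᶠ y) ≡ (b ∧ φ unit₀) xor φ (false ∷ᶠ y)
linear-∷ lin false y = refl
linear-∷ lin true  y = lin unit₀ (false ∷ᶠ y) λ { zero → refl ; (suc i) → refl }

-- The point of the hyperplane ψ = 0 above y, for a ψ with ψ unit₀ = true.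
liftThrough : ∀ {N} → ((Fin (suc N) → Bool) → Bool) → (Fin N → Bool) → Fin (suc N) → Bool
liftThrough ψ y = ψ (false ∷ᶠ y) ∷ᶠ y

liftThrough-root : ∀ {N} {ψ : (Fin (suc N) → Bool) → Bool} → IsLinear ψ → ψ unit₀ ≡ true →
                   ∀ y → ψ (liftThrough ψ y) ≡ false
liftThrough-root {ψ = ψ} lin pivot y = begin
  ψ (c ∷ᶠ y)               ≡⟨ linear-∷ lin c y ⟩
  (c ∧ ψ unit₀) xor c      ≡⟨ cong (λ t → (c ∧ t) xor c) pivot ⟩
  (c ∧ true) xor c         ≡⟨ cong (_xor c) (∧-identityʳ c) ⟩
  c xor c                  ≡⟨ xor-same c ⟩
  false                    ∎
  where
  c = ψ (false ∷ᶠ y)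

∘liftThrough-linear : ∀ {N} {ψ φ : (Fin (suc N) → Bool) → Bool} → IsLinear ψ → IsLinear φ →
                      IsLinear (φ ∘ liftThrough ψ)
∘liftThrough-linear {ψ = ψ} linψ linφ f g h≡ =
  linφ (liftThrough ψ f) (liftThrough ψ g) λ where
    zero    → linψ (false ∷ᶠ f) (false ∷ᶠ g) λ { zero → refl ; (suc i) → h≡ i }
    (suc i) → h≡ i

common-nonzero-root : ∀ N (Φ : List ((Fin N → Bool) → Bool)) → All IsLinear Φ → length Φ < N →
                      ∃[ g ] (∃[ i ] g i ≡ true) × All (λ φ → φ g ≡ false) Φ
common-nonzero-root (suc N) Φ lin len with all? (λ φ → φ unit₀ ≟ false) Φ
... | yes Φ-vanish = unit₀ , (zero , refl) , Φ-vanish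
... | no ¬Φ-vanish = eliminate (¬All⇒Any¬ (λ φ → φ unit₀ ≟ false) Φ ¬Φ-vanish)
  where
  eliminate : Any (λ φ → φ unit₀ ≢ false) Φ →
              ∃[ g ] (∃[ i ] g i ≡ true) × All (λ φ → φ g ≡ false) Φ
  eliminate pivot
    with linψ , ψ≢0 ← lookupAny lin pivot
    with y , (i , yi) , roots ←
           common-nonzero-root N (map (_∘ liftThrough (Any.lookup pivot)) (Φ ─ pivot))
             (map⁺ (All.map (∘liftThrough-linear linψ) (─⁺ pivot lin)))
             (subst (_< N) (sym (length-map _ (Φ ─ pivot)))
               (s<s⁻¹ (subst (_< suc N) (length-removeAt′ Φ (index pivot)) len)))
    = liftThrough (Any.lookup pivot) y , (suc i , yi) ,
      ─⁻ pivot (liftThrough-root linψ (¬-not ψ≢0) y) (map⁻ roots)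

-- Lower bound

bit : Bool → Fin 2
bit false = zero
bit true  = suc zero

fromBit : Fin 2 → Bool
fromBit zero       = false
fromBit (suc zero) = true

bit-fromBit : ∀ j → bit (fromBit j) ≡ j
bit-fromBit zero       = refl
bit-fromBit (suc zero) = refl

encode : ∀ {n} → Vec Bool n → Fin (2 ^ n)
encode []      = zero
encode (b ∷ x) = combine (bit b) (encode x)

decode : ∀ n → Fin (2 ^ n) → Vec Bool n
decode zero    _ = []
decode (suc n) i = fromBit (quotient (2 ^ n) i) ∷ decode n (remainder {2} (2 ^ n) i)

encode-decode : ∀ n i → encode (decode n i) ≡ i
encode-decode zero    zero = refl
encode-decode (suc n) i    =
  trans (cong₂ combine (bit-fromBit (quotient (2 ^ n) i))
                       (encode-decode n (remainder {2} (2 ^ n) i)))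
        (combine-remQuot {2} (2 ^ n) i)

colorsAll⇒size≥ : ∀ {n} {S L : VSet (Q (suc n))} → (∀ v → Colored (Q (suc n)) S L v) →
                  2 ^ n ≤ size (Q (suc n)) S
colorsAll⇒size≥ {n} {S} colorsAll = ≮⇒≥ small⇒⊥
  where
  nullVector : (Fin (2 ^ n) → Bool) → Vec Bool (suc n) → Bool
  nullVector g = extend (odd (suc n)) (g ∘ encode)

  Svertices : List (Vec Bool (suc n))
  Svertices = filter (λ v → S v ≟ true) (allVecs (suc n))

  evaluations : List ((Fin (2 ^ n) → Bool) → Bool)
  evaluations = map (λ v g → nullVector g v) Svertices

  evaluations-linear : All IsLinear evaluations
  evaluations-linear = map⁺ (universal (λ v f g {_} h≡ →
    extend-linear (odd (suc n)) (f ∘ encode) (g ∘ encode) (h≡ ∘ encode) v) Svertices)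

  length-evaluations : length evaluations ≡ size (Q (suc n)) S
  length-evaluations = trans (length-map _ Svertices) (sym (size-filter (Q (suc n)) S))

  nullVector-vanishes : ∀ g → All (λ φ → φ g ≡ false) evaluations → ∀ v → nullVector g v ≡ false
  nullVector-vanishes g g|S v =
    inKernel-vanishes {e = odd (suc n)}
      (extend-inKernel (odd (suc n)) (g ∘ encode) (shiftedAdj-involutive (g ∘ encode)))
      (λ v Sv → All.lookup (map⁻ g|S) (∈-filter⁺ (λ v → S v ≟ true) (∈-allVecs v) Sv))
      (colorsAll v)

  small⇒⊥ : size (Q (suc n)) S < 2 ^ n → ⊥
  small⇒⊥ small
    with g , (i , gi) , g|S ← common-nonzero-root (2 ^ n) evaluations evaluations-linear
                                (subst (_< 2 ^ n) (sym length-evaluations) small)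
    with () ← trans (trans (sym gi) (cong g (sym (encode-decode n i))))
                    (nullVector-vanishes g g|S (false ∷ decode n i))

proposition19 : ∀ (d : ℕ) → 2 ≤ d → ZℓIs 1 (Q d) (2 ^ (d ∸ 1))
proposition19 (suc zero) (s≤s ())
proposition19 (suc (suc n)) _ =
  (lowerHalf , lowerHalf-isForcingSet n , size-lowerHalf (suc n)) ,
  λ S S-forces → colorsAll⇒size≥ (S-forces (λ _ → false) noLeaks)
  where
  noLeaks : size (Q (suc (suc n))) (λ _ → false) ≤ 1
  noLeaks = subst (_≤ 1) (sym (size-∅ (Q (suc (suc n))))) z≤n
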